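{- Let $G$ be a connected maximal nontraceable graph and let $v\in V(G)$ with $d(v)=2$. Then the two neighbours of $v$ are adjacent. Moreover, one of the neighbours of $v$ has degree at least $4$, and the other neighbour has degree $2$ or degree at least $4$.
   Context: Graphs are simple and finite. A graph is traceable if it has a hamiltonian path. A graph $G$ is maximal nontraceable if $G$ is not traceable but $G+e$ is traceable for every pair of nonadjacent vertices joined by a new edge $e$. $d(v)$ denotes the degree of $v$ in $G$. -}

module Defs where

open import Data.Nat using (ℕ)
open import Data.Bool using (Bool; true; false; _∨_; _∧_)
open import Data.Fin using (Fin; _≟_)
open import Data.List using (List; length; filter; allFin)
open import Data.List.Relation.Unary.Linked using (Linked)
open import Data.List.Relation.Binary.Permutation.Propositional using (_↭_)
open import Data.Product using (∃; _×_)
open import Relation.Nullary using (¬_; does)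
open import Relation.Binary.PropositionalEquality using (_≡_)

AdjRel : ℕ → Set
AdjRel n = Fin n → Fin n → Bool

record Graph (n : ℕ) : Set where
  field
    adj   : AdjRel n
    sym   : ∀ u v → adj u v ≡ adj v u
    irrfl : ∀ v → adj v v ≡ false
open Graph public

Adj : ∀ {n} → AdjRel n → Fin n → Fin n → Set
Adj a u v = a u v ≡ true

deg : ∀ {n} → Graph n → Fin n → ℕ
deg {n} G v = length (filter (λ u → adj G v u Data.Bool.≟ true) (allFin n))

IsHamPath : ∀ {n} → AdjRel n → List (Fin n) → Set
IsHamPath {n} a p = (p ↭ allFin n) × Linked (Adj a) p

Traceable : ∀ {n} → AdjRel n → Set
Traceable a = ∃ λ p → IsHamPath a p

eqb : ∀ {n} → Fin n → Fin n → Bool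
eqb x y = does (x ≟ y)

addEdge : ∀ {n} → AdjRel n → Fin n → Fin n → AdjRel n
addEdge a u v x y = a x y ∨ ((eqb x u ∧ eqb y v) ∨ (eqb x v ∧ eqb y u))

data Walk {n} (G : Graph n) : Fin n → Fin n → Set where
  here : ∀ {u} → Walk G u u
  step : ∀ {u w v} → Adj (adj G) u w → Walk G w v → Walk G u v

Connected : ∀ {n} → Graph n → Set
Connected G = ∀ u v → Walk G u v

MaximalNontraceable : ∀ {n} → Graph n → Set
MaximalNontraceable G =
  ¬ Traceable (adj G) ×
  (∀ u v → ¬ (u ≡ v) → ¬ Adj (adj G) u v → Traceable (addEdge (adj G) u v))

{-# OPTIONS --safe #-}
-- Let N(v) = {x, y}.  If x ≁ y, a hamiltonian path of G + xy is split by the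
-- new edge into two paths of G starting at x and y; v must be the whole rest of
-- one of them, and inserting v between x and y gives a hamiltonian path of G.
-- If N(x) = {v, y, w}, then in G + vw the vertices v and x are adjacent twins:
-- transposing them maps a hamiltonian path of G + vw to one of G, unless the path
-- also uses xw, in which case it can be rerouted around the triangle v x y.
-- Finally, if x and y both had degree 2, the triangle v x y would be a component
-- of G, hence all of G, and v x y would be a hamiltonian path.
module Submission where

open import Defs
open import Data.Bool using (true; false)
import Data.Bool as Bool
open import Data.Empty using (⊥; ⊥-elim)
open import Data.Fin using (Fin; _≟_)
open import Data.Fin.Permutation using (Permutation′; _⟨$⟩ʳ_; _⟨$⟩ˡ_; inverseˡ; inverseʳ; transpose)
import Data.Fin.Permutation.Components as PC
open import Data.List using (List; []; _∷_; _++_; [_]; _∷ʳ_; _ʳ++_; reverse; length; map; filter; allFin)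
open import Data.List.Properties using (map-++; reverse-++)
open import Data.List.Membership.Propositional using (_∈_; _∉_; find)
open import Data.List.Membership.Propositional.Properties
  using (∈-++⁺ˡ; ∈-++⁺ʳ; ∈-++⁻; ∈-∃++; ∈-map⁺; ∈-allFin; ∈-filter⁺; ∈-filter⁻)
open import Data.List.Membership.Propositional.Properties.WithK using (unique∧set⇒bag)
open import Data.List.Relation.Binary.BagAndSetEquality using (∼bag⇒↭)
open import Data.List.Relation.Binary.Permutation.Propositional
  using (_↭_; prep; swap; ↭-refl; ↭-sym; ↭-trans; ↭⇒↭ₛ)
open import Data.List.Relation.Binary.Permutation.Propositional.Properties
  using (++⁺ˡ; ++⁺ʳ; ++-comm; shift; ++↭ʳ++; ↭-reverse; ↭-length; ∈-resp-↭)
import Data.List.Relation.Binary.Permutation.Propositional.Properties as Permutation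
import Data.List.Relation.Binary.Permutation.Setoid.Properties as PermutationSetoid
open import Data.List.Relation.Binary.Subset.Propositional using (_⊆_)
open import Data.List.Relation.Binary.Subset.Propositional.Properties
  using (⊆-refl; ⊆-respʳ-↭; xs⊆x∷xs; ∷⁺ʳ; xs⊆xs++ys; ∈-∷⁺ʳ)
open import Data.List.Relation.Unary.All as All using (All; []; _∷_; all?)
open import Data.List.Relation.Unary.All.Properties using (¬Any⇒All¬; ¬All⇒Any¬)
open import Data.List.Relation.Unary.AllPairs using ([]; _∷_)
open import Data.List.Relation.Unary.Any using (here; there)
open import Data.List.Relation.Unary.Linked as Linked using (Linked; []; [-]; _∷_)
import Data.List.Relation.Unary.Linked.Properties as Linkedₚ
open import Data.List.Relation.Unary.Unique.Propositional using (Unique)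
open import Data.List.Relation.Unary.Unique.Propositional.Properties
  using (allFin⁺; filter⁺; Unique[x∷xs]⇒x∉xs)
import Data.List.Relation.Unary.Unique.Propositional.Properties as Unique
open import Data.Nat using (ℕ; _≤_; z≤n; s≤s)
open import Data.Nat.Properties using (≤-trans; ≤-reflexive; ≤-antisym)
open import Data.Product using (Σ; ∃; ∃₂; _×_; _,_; proj₁; proj₂)
open import Data.Sum using (_⊎_; inj₁; inj₂)
open import Function using (_on_; _∘_)
open import Function.Bundles using (mk⇔)
open import Level using (0ℓ)
open import Relation.Binary.Construct.Union using (_∪_)
open import Relation.Binary.Core using (Rel)
open import Relation.Binary.Definitions using (Symmetric; DecidableEquality)
open import Relation.Binary.PropositionalEquality
  using (_≡_; _≢_; refl; trans; cong; subst; subst₂; setoid; ≢-sym)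
import Relation.Binary.PropositionalEquality as ≡
open import Relation.Nullary using (¬_; Dec; yes; no)

module _ {A : Set} where

  Unique-++⇒disjoint : ∀ {xs ys : List A} {z} → Unique (xs ++ ys) → z ∈ xs → z ∈ ys → ⊥
  Unique-++⇒disjoint {x ∷ xs} (x∉ ∷ _) (here refl) z∈ys = All.lookup x∉ (∈-++⁺ʳ xs z∈ys) refl
  Unique-++⇒disjoint {x ∷ xs} (_ ∷ u) (there z∈xs) z∈ys = Unique-++⇒disjoint u z∈xs z∈ys

  Unique-++⁻ʳ : ∀ xs {ys : List A} → Unique (xs ++ ys) → Unique ys
  Unique-++⁻ʳ [] u = u
  Unique-++⁻ʳ (_ ∷ xs) (_ ∷ u) = Unique-++⁻ʳ xs u

  Unique-⊆⇒length≤ : ∀ {xs ys : List A} → Unique xs → xs ⊆ ys → length xs ≤ length ys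
  Unique-⊆⇒length≤ {[]} _ _ = z≤n
  Unique-⊆⇒length≤ {x ∷ xs} (x∉xs ∷ u) x∷xs⊆ys with ∈-∃++ (x∷xs⊆ys (here refl))
  ... | as , bs , refl =
    ≤-trans (s≤s (Unique-⊆⇒length≤ u xs⊆as++bs)) (≤-reflexive (≡.sym (↭-length (shift x as bs))))
    where
    xs⊆as++bs : xs ⊆ as ++ bs
    xs⊆as++bs z∈xs with ∈-resp-↭ (shift x as bs) (x∷xs⊆ys (there z∈xs))
    ... | here refl = ⊥-elim (All.lookup x∉xs z∈xs refl)
    ... | there z∈ = z∈

  Unique-length≡2 : ∀ {xs : List A} → Unique xs → length xs ≡ 2 →
    ∃₂ λ x y → x ≢ y × x ∈ xs × y ∈ xs × xs ⊆ x ∷ y ∷ []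
  Unique-length≡2 {x ∷ y ∷ []} ((x≢y ∷ []) ∷ _) refl = x , y , x≢y , here refl , there (here refl) , ⊆-refl

  module _ (_≟ₐ_ : DecidableEquality A) where
    open import Data.List.Membership.DecPropositional _≟ₐ_ using (_∈?_)

    Unique-⊆-extend : ∀ {xs ys} → Unique xs → Unique ys → xs ⊆ ys →
      (ys ⊆ xs × length ys ≡ length xs) ⊎ ∃ λ y → Unique (y ∷ xs) × y ∷ xs ⊆ ys
    Unique-⊆-extend {xs} {ys} u uys xs⊆ys with all? (_∈? xs) ys
    ... | yes ys⊆xs = inj₁ (All.lookup ys⊆xs ,
          ≤-antisym (Unique-⊆⇒length≤ uys (All.lookup ys⊆xs)) (Unique-⊆⇒length≤ u xs⊆ys))
    ... | no ys⊈xs with find (¬All⇒Any¬ (_∈? xs) ys ys⊈xs)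
    ...   | y , y∈ys , y∉xs = inj₂ (y , ¬Any⇒All¬ xs y∉xs ∷ u , ∈-∷⁺ʳ y∈ys xs⊆ys)

  SingleEdge : A → A → Rel A 0ℓ
  SingleEdge s t a b = (a ≡ s × b ≡ t) ⊎ (a ≡ t × b ≡ s)

  SingleEdge-endpoint : ∀ {s t a b c d} → SingleEdge s t a b → SingleEdge s t c d → a ≡ c ⊎ a ≡ d
  SingleEdge-endpoint (inj₁ (refl , _)) (inj₁ (refl , _)) = inj₁ refl
  SingleEdge-endpoint (inj₁ (refl , _)) (inj₂ (_ , refl)) = inj₂ refl
  SingleEdge-endpoint (inj₂ (refl , _)) (inj₁ (_ , refl)) = inj₂ refl
  SingleEdge-endpoint (inj₂ (refl , _)) (inj₂ (refl , _)) = inj₁ refl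

module _ {A : Set} {R : Rel A 0ℓ} where

  Linked-predecessor : ∀ {u xs z} → Linked R (u ∷ xs) → z ∈ xs → ∃ λ p → p ∈ u ∷ xs × R p z
  Linked-predecessor (r ∷ _) (here refl) = _ , here refl , r
  Linked-predecessor (_ ∷ l) (there z∈xs) with Linked-predecessor l z∈xs
  ... | p , p∈ , r = p , there p∈ , r

  Linked-∷-prefix : ∀ {p q rest} B {a cs} → R p q → q ∷ rest ≡ B ++ a ∷ cs →
    Linked R (B ∷ʳ a) → Linked R (p ∷ B ∷ʳ a)
  Linked-∷-prefix [] r refl l = r ∷ l
  Linked-∷-prefix (_ ∷ _) r refl l = r ∷ l

  module _ (R-sym : Symmetric R) where

    Linked-ʳ++ : ∀ {x} xs {ys} → Linked R (x ∷ xs) → Linked R (x ∷ ys) → Linked R (xs ʳ++ x ∷ ys)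
    Linked-ʳ++ [] _ l = l
    Linked-ʳ++ (_ ∷ xs) (r ∷ lx) l = Linked-ʳ++ xs lx (R-sym r ∷ l)

    Linked-reverse : ∀ xs → Linked R xs → Linked R (reverse xs)
    Linked-reverse [] _ = []
    Linked-reverse (_ ∷ xs) l = Linked-ʳ++ xs l [-]

  data EdgeSplit (E : Rel A 0ℓ) (P : List A) : Set where
    split : ∀ B {a b} C → P ≡ B ++ a ∷ b ∷ C → E a b →
      Linked R (B ∷ʳ a) → Linked R (b ∷ C) → EdgeSplit E P

  module _ {E : Rel A 0ℓ} (E-endpoint : ∀ {a b c d} → E a b → E c d → a ≡ c ⊎ a ≡ d) where

    -- E relates only the two ends of one edge, so a repetition-free walk uses it at most once.
    Linked-∪-split : ∀ {P} → Unique P → Linked (R ∪ E) P → Linked R P ⊎ EdgeSplit E P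
    Linked-∪-split {[]} _ _ = inj₁ []
    Linked-∪-split {_ ∷ []} _ _ = inj₁ [-]
    Linked-∪-split {p ∷ q ∷ rest} (p∉ ∷ u) (pq ∷ l) with Linked-∪-split u l | pq
    ... | inj₁ lR | inj₁ Rpq = inj₁ (Rpq ∷ lR)
    ... | inj₁ lR | inj₂ Epq = inj₂ (split [] rest refl Epq [-] lR)
    ... | inj₂ (split B C eq Eab lB lC) | inj₁ Rpq =
          inj₂ (split (p ∷ B) C (cong (p ∷_) eq) Eab (Linked-∷-prefix B Rpq eq lB) lC)
    ... | inj₂ (split B C eq Eab _ _) | inj₂ Epq with E-endpoint Epq Eab
    ...   | inj₁ refl = ⊥-elim (All.lookup p∉ (subst (p ∈_) (≡.sym eq) (∈-++⁺ʳ B (here refl))) refl)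
    ...   | inj₂ refl = ⊥-elim (All.lookup p∉ (subst (p ∈_) (≡.sym eq) (∈-++⁺ʳ B (there (here refl)))) refl)

module _ {n : ℕ} where

  ↭allFin⇒Unique : ∀ {xs : List (Fin n)} → xs ↭ allFin n → Unique xs
  ↭allFin⇒Unique xs↭ = PermutationSetoid.Unique-resp-↭ (setoid _) (↭⇒↭ₛ (↭-sym xs↭)) (allFin⁺ n)

  Unique∧covering⇒↭allFin : ∀ {xs : List (Fin n)} → Unique xs → (∀ z → z ∈ xs) → xs ↭ allFin n
  Unique∧covering⇒↭allFin u covering =
    ∼bag⇒↭ (unique∧set⇒bag u (allFin⁺ n) (mk⇔ (λ _ → ∈-allFin _) (λ _ → covering _)))

  map-allFin-↭ : (π : Permutation′ n) → map (π ⟨$⟩ʳ_) (allFin n) ↭ allFin n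
  map-allFin-↭ π = Unique∧covering⇒↭allFin (Unique.map⁺ injective (allFin⁺ n)) covering
    where
    injective : ∀ {a b} → π ⟨$⟩ʳ a ≡ π ⟨$⟩ʳ b → a ≡ b
    injective eq = trans (≡.sym (inverseˡ π)) (trans (cong (π ⟨$⟩ˡ_) eq) (inverseˡ π))
    covering : ∀ z → z ∈ map (π ⟨$⟩ʳ_) (allFin n)
    covering z = subst (_∈ _) (inverseʳ π) (∈-map⁺ (π ⟨$⟩ʳ_) (∈-allFin (π ⟨$⟩ˡ z)))

  data Transposition (i j : Fin n) : Fin n → Fin n → Set where
    source : Transposition i j i j
    target : Transposition i j j i
    fixed  : ∀ {k} → k ≢ i → k ≢ j → Transposition i j k k

  transposition : ∀ i j k → Transposition i j k (PC.transpose i j k)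
  transposition i j k with k ≟ i
  ... | yes refl = source
  ... | no k≢i with k ≟ j
  ...   | yes refl = target
  ...   | no k≢j = fixed k≢i k≢j

  transpose-source : ∀ i j → PC.transpose i j i ≡ j
  transpose-source i j = image (transposition i j i)
    where
    image : ∀ {k} → Transposition i j i k → k ≡ j
    image source = refl
    image target = refl
    image (fixed i≢i _) = ⊥-elim (i≢i refl)

  transpose-fixed : ∀ {i j k} → k ≢ i → k ≢ j → PC.transpose i j k ≡ k
  transpose-fixed {i} {j} {k} k≢i k≢j = image (transposition i j k)
    where
    image : ∀ {k′} → Transposition i j k k′ → k′ ≡ k
    image source = ⊥-elim (k≢i refl)
    image target = ⊥-elim (k≢j refl)
    image (fixed _ _) = refl

module _ {n} (G : Graph n) where

  infix 4 _~_ _~?_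

  _~_ : Fin n → Fin n → Set
  _~_ = Adj (adj G)

  _~?_ : ∀ u w → Dec (u ~ w)
  u ~? w = adj G u w Bool.≟ true

  ~-sym : Symmetric _~_
  ~-sym {u} {w} u~w = trans (Graph.sym G w u) u~w

  ~-irrefl : ∀ {u w} → u ~ w → u ≢ w
  ~-irrefl {u} u~u refl with trans (≡.sym u~u) (irrfl G u)
  ... | ()

  neighbours : Fin n → List (Fin n)
  neighbours v = filter (λ u → adj G v u Bool.≟ true) (allFin n)

  ∈-neighbours⁺ : ∀ {v u} → v ~ u → u ∈ neighbours v
  ∈-neighbours⁺ {v} {u} = ∈-filter⁺ (λ u → adj G v u Bool.≟ true) (∈-allFin u)

  ∈-neighbours⁻ : ∀ {v u} → u ∈ neighbours v → v ~ u
  ∈-neighbours⁻ {v} = proj₂ ∘ ∈-filter⁻ (λ u → adj G v u Bool.≟ true) {xs = allFin n}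

  neighbours-Unique : ∀ v → Unique (neighbours v)
  neighbours-Unique v = filter⁺ (λ u → adj G v u Bool.≟ true) (allFin⁺ n)

  degree-2-neighbours : ∀ {v} → deg G v ≡ 2 →
    ∃₂ λ x y → x ≢ y × neighbours v ⊆ x ∷ y ∷ [] × v ~ x × v ~ y
  degree-2-neighbours {v} deg≡2 with Unique-length≡2 (neighbours-Unique v) deg≡2
  ... | x , y , x≢y , x∈ , y∈ , N[v] = x , y , x≢y , N[v] , ∈-neighbours⁻ x∈ , ∈-neighbours⁻ y∈

  addEdge⇒ : ∀ {s t a b} → Adj (addEdge (adj G) s t) a b → a ~ b ⊎ SingleEdge s t a b
  addEdge⇒ {s} {t} {a} {b} _ with adj G a b | a ≟ s | b ≟ t | a ≟ t | b ≟ s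
  ... | true  | _        | _        | _        | _        = inj₁ refl
  ... | false | yes refl | yes refl | _        | _        = inj₂ (inj₁ (refl , refl))
  ... | false | _        | _        | yes refl | yes refl = inj₂ (inj₂ (refl , refl))
  addEdge⇒ () | false | no _  | _    | no _  | _
  addEdge⇒ () | false | no _  | _    | yes _ | no _
  addEdge⇒ () | false | yes _ | no _ | no _  | _
  addEdge⇒ () | false | yes _ | no _ | yes _ | no _

  Walk-closed : ∀ {S : List (Fin n)} → (∀ {a b} → a ∈ S → a ~ b → b ∈ S) →
    ∀ {a b} → Walk G a b → a ∈ S → b ∈ S
  Walk-closed closed here a∈S = a∈S
  Walk-closed closed (step a~c walk) a∈S = Walk-closed closed walk (closed a∈S a~c)

  module Spanning {s t X Y} (spanning : s ∷ X ++ t ∷ Y ↭ allFin n) where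

    private
      unique : Unique (s ∷ X ++ t ∷ Y)
      unique = ↭allFin⇒Unique spanning

    disjoint : ∀ {z} → z ∈ s ∷ X → z ∈ t ∷ Y → ⊥
    disjoint = Unique-++⇒disjoint unique

    s∉X : s ∉ X
    s∉X = Unique[x∷xs]⇒x∉xs unique ∘ ∈-++⁺ˡ

    t∉Y : t ∉ Y
    t∉Y = Unique[x∷xs]⇒x∉xs (Unique-++⁻ʳ (s ∷ X) unique)

  -- Equivalently: a hamiltonian path of G + st through the edge st.
  record PathCover (s t : Fin n) : Set where
    constructor cover
    field
      sTail tTail : List (Fin n)
      sPath    : Linked _~_ (s ∷ sTail)
      tPath    : Linked _~_ (t ∷ tTail)
      spanning : s ∷ sTail ++ t ∷ tTail ↭ allFin n

  PathCover-swap : ∀ {s t} → PathCover s t → PathCover t s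
  PathCover-swap {s} {t} (cover X Y lx ly p) = cover Y X ly lx (↭-trans (++-comm (t ∷ Y) (s ∷ X)) p)

  PathCover-join : ∀ {s t} → PathCover s t → s ~ t → Traceable (adj G)
  PathCover-join {s} {t} (cover X Y lx ly p) s~t =
    X ʳ++ s ∷ t ∷ Y ,
    ↭-trans (↭-sym (++↭ʳ++ X (s ∷ t ∷ Y))) (↭-trans (shift s X (t ∷ Y)) p) ,
    Linked-ʳ++ ~-sym X lx (s~t ∷ ly)

  PathCover-map : ∀ {s t} (π : Permutation′ n) (c : PathCover s t) → let open PathCover c in
    Linked (_~_ on (π ⟨$⟩ʳ_)) (s ∷ sTail) → Linked (_~_ on (π ⟨$⟩ʳ_)) (t ∷ tTail) →
    PathCover (π ⟨$⟩ʳ s) (π ⟨$⟩ʳ t)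
  PathCover-map {s} {t} π (cover X Y _ _ p) lx ly =
    cover (map f X) (map f Y) (Linkedₚ.map⁺ lx) (Linkedₚ.map⁺ ly)
      (subst (_↭ allFin n) (map-++ f (s ∷ X) (t ∷ Y))
        (↭-trans (Permutation.map⁺ f p) (map-allFin-↭ π)))
    where
    f = π ⟨$⟩ʳ_

  split⇒PathCover : ∀ B {a b C} → Linked _~_ (B ∷ʳ a) → Linked _~_ (b ∷ C) →
    B ++ a ∷ b ∷ C ↭ allFin n → PathCover a b
  split⇒PathCover B {a} {b} {C} lB lC p =
    cover (reverse B) C
      (subst (Linked _~_) (reverse-++ B [ a ]) (Linked-reverse ~-sym (B ∷ʳ a) lB)) lC
      (↭-trans (↭-sym (shift a (reverse B) (b ∷ C))) (↭-trans (++⁺ʳ (a ∷ b ∷ C) (↭-reverse B)) p))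

  nonadjacent⇒PathCover : MaximalNontraceable G → ∀ {s t} → s ≢ t → ¬ s ~ t → PathCover s t
  nonadjacent⇒PathCover (nontraceable , maximal) {s} {t} s≢t s≁t with maximal s t s≢t s≁t
  ... | P , P↭ , linked
      with Linked-∪-split {R = _~_} SingleEdge-endpoint (↭allFin⇒Unique P↭) (Linked.map addEdge⇒ linked)
  ... | inj₁ linked′ = ⊥-elim (nontraceable (P , P↭ , linked′))
  ... | inj₂ (split B C refl (inj₁ (refl , refl)) lB lC) = split⇒PathCover B lB lC P↭
  ... | inj₂ (split B C refl (inj₂ (refl , refl)) lB lC) = PathCover-swap (split⇒PathCover B lB lC P↭)

  -- Such a z is the entire tail of the s-path, and s z t ⋯ is a hamiltonian path.
  pendant⇒traceable : ∀ {s t z} (c : PathCover s t) → z ∈ PathCover.sTail c →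
    neighbours z ⊆ s ∷ t ∷ [] → z ~ t → Traceable (adj G)
  pendant⇒traceable (cover (_ ∷ []) Y (s~z ∷ _) ly p) (here refl) _ z~t = _ , p , s~z ∷ z~t ∷ ly
  pendant⇒traceable (cover (_ ∷ b ∷ _) Y (_ ∷ z~b ∷ _) _ p) (here refl) N[z] _
    with N[z] (∈-neighbours⁺ z~b)
  ... | here refl = ⊥-elim (Spanning.s∉X p (there (here refl)))
  ... | there (here refl) = ⊥-elim (Spanning.disjoint p (there (there (here refl))) (here refl))
  pendant⇒traceable (cover (_ ∷ X) Y (_ ∷ lz) _ p) (there z∈X) N[z] _
    with Linked-predecessor lz z∈X
  ... | q , q∈ , q~z with N[z] (∈-neighbours⁺ (~-sym q~z))
  ...   | here refl = ⊥-elim (Spanning.s∉X p q∈)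
  ...   | there (here refl) = ⊥-elim (Spanning.disjoint p (there q∈) (here refl))

  degree-2-neighbours-adjacent : MaximalNontraceable G → ∀ {v x y} →
    neighbours v ⊆ x ∷ y ∷ [] → v ~ x → v ~ y → x ≢ y → x ~ y
  degree-2-neighbours-adjacent mnt {v} {x} {y} N[v] v~x v~y x≢y with x ~? y
  ... | yes x~y = x~y
  ... | no x≁y = ⊥-elim (proj₁ mnt (traceable (nonadjacent⇒PathCover mnt x≢y x≁y)))
    where
    traceable : PathCover x y → Traceable (adj G)
    traceable c with ∈-++⁻ (x ∷ _) (∈-resp-↭ (↭-sym (PathCover.spanning c)) (∈-allFin v))
    ... | inj₁ (here refl) = ⊥-elim (~-irrefl v~x refl)
    ... | inj₁ (there v∈X) = pendant⇒traceable c v∈X N[v] v~y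
    ... | inj₂ (here refl) = ⊥-elim (~-irrefl v~y refl)
    ... | inj₂ (there v∈Y) =
          pendant⇒traceable (PathCover-swap c) v∈Y (⊆-respʳ-↭ (swap x y ↭-refl) N[v]) v~x

  module Twins {v x w : Fin n}
    (N[v]⊆N[x] : ∀ {u} → v ~ u → u ≢ x → x ~ u)
    (N[x]⊆N[v] : ∀ {u} → x ~ u → u ≢ v → u ≢ w → v ~ u) where

    τ : Fin n → Fin n
    τ = PC.transpose v x

    -- The side conditions say {a, b} ≠ {x, w}.
    transpose-~ : ∀ {a b} → a ~ b → (a ≡ x → w ≢ b) → (b ≡ x → w ≢ a) → τ a ~ τ b
    transpose-~ {a} {b} = image (transposition v x a) (transposition v x b)
      where
      image : ∀ {a a′ b b′} → Transposition v x a a′ → Transposition v x b b′ →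
        a ~ b → (a ≡ x → w ≢ b) → (b ≡ x → w ≢ a) → a′ ~ b′
      image source source v~v _ _ = ⊥-elim (~-irrefl v~v refl)
      image source target v~x _ _ = ~-sym v~x
      image source (fixed _ b≢x) v~b _ _ = N[v]⊆N[x] v~b b≢x
      image target source x~v _ _ = ~-sym x~v
      image target target x~x _ _ = ⊥-elim (~-irrefl x~x refl)
      image target (fixed b≢v _) x~b w≢b _ = N[x]⊆N[v] x~b b≢v (≢-sym (w≢b refl))
      image (fixed _ a≢x) source a~v _ _ = ~-sym (N[v]⊆N[x] (~-sym a~v) a≢x)
      image (fixed a≢v _) target a~x _ w≢a = ~-sym (N[x]⊆N[v] (~-sym a~x) a≢v (≢-sym (w≢a refl)))
      image (fixed _ _) (fixed _ _) a~b _ _ = a~b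

    Linked-transpose : ∀ {xs} → Linked _~_ xs → All (w ≢_) xs → Linked (_~_ on τ) xs
    Linked-transpose [] _ = []
    Linked-transpose [-] _ = [-]
    Linked-transpose (a~b ∷ l) (w≢a ∷ w≢b ∷ ws) =
      transpose-~ a~b (λ _ → w≢b) (λ _ → w≢a) ∷ Linked-transpose l (w≢b ∷ ws)

  degree-2-3-triangle⇒traceable : MaximalNontraceable G → ∀ {v x y w} →
    neighbours v ⊆ x ∷ y ∷ [] → neighbours x ⊆ w ∷ v ∷ y ∷ [] →
    v ~ x → v ~ y → x ~ y → x ~ w → w ≢ v → w ≢ y → Traceable (adj G)
  degree-2-3-triangle⇒traceable mnt {v} {x} {y} {w} N[v] N[x] v~x v~y x~y x~w w≢v w≢y =
    traceable (nonadjacent⇒PathCover mnt (≢-sym w≢v) v≁w)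
    where
    v≁w : ¬ v ~ w
    v≁w v~w with N[v] (∈-neighbours⁺ v~w)
    ... | here refl = ~-irrefl x~w refl
    ... | there (here refl) = w≢y refl

    N[v]⊆N[x] : ∀ {u} → v ~ u → u ≢ x → x ~ u
    N[v]⊆N[x] v~u u≢x with N[v] (∈-neighbours⁺ v~u)
    ... | here refl = ⊥-elim (u≢x refl)
    ... | there (here refl) = x~y

    N[x]⊆N[v] : ∀ {u} → x ~ u → u ≢ v → u ≢ w → v ~ u
    N[x]⊆N[v] x~u u≢v u≢w with N[x] (∈-neighbours⁺ x~u)
    ... | here refl = ⊥-elim (u≢w refl)
    ... | there (here refl) = ⊥-elim (u≢v refl)
    ... | there (there (here refl)) = v~y

    open Twins N[v]⊆N[x] N[x]⊆N[v]

    w≢x : w ≢ x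
    w≢x = ~-irrefl x~w ∘ ≡.sym

    twins : (c : PathCover v w) → Linked (_~_ on τ) (w ∷ PathCover.tTail c) → Traceable (adj G)
    twins c lw = PathCover-join (subst₂ PathCover (transpose-source v x) (transpose-fixed w≢v w≢x)
      (PathCover-map (transpose v x) c (Linked-transpose (PathCover.sPath c) w∉v-path) lw)) x~w
      where
      w∉v-path = ¬Any⇒All¬ _ (λ w∈ → Spanning.disjoint (PathCover.spanning c) w∈ (here refl))

    -- The w-path starts w x, so the transposed cover would use vw; reroute through v x y instead.
    through-wx : ∀ X Y → Linked _~_ (v ∷ X) → Linked _~_ (w ∷ x ∷ Y) →
      v ∷ X ++ w ∷ x ∷ Y ↭ allFin n → Traceable (adj G)
    through-wx X [] lx _ p =
      PathCover-join (cover X [ w ] lx (x~w ∷ [-]) (↭-trans (++⁺ˡ (v ∷ X) (swap x w ↭-refl)) p)) v~x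
    through-wx X (b ∷ Y) lx (_ ∷ x~b ∷ lb) p with N[x] (∈-neighbours⁺ x~b)
    ... | here refl = ⊥-elim (Spanning.t∉Y p (there (here refl)))
    ... | there (here refl) = ⊥-elim (Spanning.disjoint p (here refl) (there (there (here refl))))
    ... | there (there (here refl)) with X | lx
    ...   | [] | _ =
            w ∷ x ∷ v ∷ y ∷ Y ,
            ↭-trans (prep w (swap x v ↭-refl)) (↭-trans (swap w v ↭-refl) p) ,
            ~-sym x~w ∷ ~-sym v~x ∷ v~y ∷ lb
    ...   | a ∷ _ | v~a ∷ _ with N[v] (∈-neighbours⁺ v~a)
    ...     | here refl = ⊥-elim (Spanning.disjoint p (there (here refl)) (there (here refl)))
    ...     | there (here refl) =
              ⊥-elim (Spanning.disjoint p (there (here refl)) (there (there (here refl))))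

    traceable : PathCover v w → Traceable (adj G)
    traceable c@(cover _ [] _ _ _) = twins c [-]
    traceable c@(cover X (h ∷ Y) lx (w~h ∷ lh) p) with h ≟ x
    ... | yes refl = through-wx X Y lx (w~h ∷ lh) p
    ... | no h≢x = twins c (transpose-~ w~h (⊥-elim ∘ w≢x) (⊥-elim ∘ h≢x) ∷
                            Linked-transpose lh (¬Any⇒All¬ _ (Spanning.t∉Y p)))

  degree-2-triangle⇒traceable : Connected G → ∀ {v x y} →
    neighbours v ⊆ x ∷ y ∷ [] → neighbours x ⊆ v ∷ y ∷ [] → neighbours y ⊆ v ∷ x ∷ [] →
    v ~ x → v ~ y → x ~ y → Traceable (adj G)
  degree-2-triangle⇒traceable conn {v} {x} {y} N[v] N[x] N[y] v~x v~y x~y =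
    v ∷ x ∷ y ∷ [] ,
    Unique∧covering⇒↭allFin unique (λ z → Walk-closed closed (conn v z) (here refl)) ,
    v~x ∷ x~y ∷ [-]
    where
    unique : Unique (v ∷ x ∷ y ∷ [])
    unique = (~-irrefl v~x ∷ ~-irrefl v~y ∷ []) ∷ (~-irrefl x~y ∷ []) ∷ [] ∷ []
    closed : ∀ {a b} → a ∈ v ∷ x ∷ y ∷ [] → a ~ b → b ∈ v ∷ x ∷ y ∷ []
    closed (here refl) a~b = xs⊆x∷xs _ v (N[v] (∈-neighbours⁺ a~b))
    closed (there (here refl)) a~b = ∷⁺ʳ v (xs⊆x∷xs _ x) (N[x] (∈-neighbours⁺ a~b))
    closed (there (there (here refl))) a~b = xs⊆xs++ys (v ∷ x ∷ []) [ y ] (N[y] (∈-neighbours⁺ a~b))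

  triangle-vertex-degree : MaximalNontraceable G → ∀ {v x y} →
    neighbours v ⊆ x ∷ y ∷ [] → v ~ x → v ~ y → x ~ y →
    (deg G x ≡ 2 × neighbours x ⊆ v ∷ y ∷ []) ⊎ 4 ≤ deg G x
  triangle-vertex-degree mnt {v} {x} {y} N[v] v~x v~y x~y
    with Unique-⊆-extend _≟_ ((~-irrefl v~y ∷ []) ∷ [] ∷ []) (neighbours-Unique x)
           (∈-∷⁺ʳ (∈-neighbours⁺ (~-sym v~x)) (∈-∷⁺ʳ (∈-neighbours⁺ x~y) λ ()))
  ... | inj₁ (N[x] , deg≡2) = inj₁ (deg≡2 , N[x])
  ... | inj₂ (w , u@((w≢v ∷ w≢y ∷ []) ∷ _) , ⊆N[x])
      with Unique-⊆-extend _≟_ u (neighbours-Unique x) ⊆N[x]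
  ...   | inj₁ (N[x] , _) = ⊥-elim (proj₁ mnt
            (degree-2-3-triangle⇒traceable mnt N[v] N[x] v~x v~y x~y (∈-neighbours⁻ (⊆N[x] (here refl))) w≢v w≢y))
  ...   | inj₂ (_ , u′ , ⊆N[x]′) = inj₂ (Unique-⊆⇒length≤ u′ ⊆N[x]′)

lemma5 : ∀ {n} (G : Graph n) → Connected G → MaximalNontraceable G →
    (v : Fin n) → deg G v ≡ 2 →
    Σ (Fin n) λ x → Σ (Fin n) λ y →
      ¬ (x ≡ y) × Adj (adj G) v x × Adj (adj G) v y ×
      Adj (adj G) x y × 4 ≤ deg G x × (deg G y ≡ 2 ⊎ 4 ≤ deg G y)
lemma5 G conn mnt v deg≡2 with degree-2-neighbours G deg≡2
... | x , y , x≢y , N[v] , v~x , v~y with degree-2-neighbours-adjacent G mnt N[v] v~x v~y x≢y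
... | x~y with triangle-vertex-degree G mnt N[v] v~x v~y x~y
             | triangle-vertex-degree G mnt (⊆-respʳ-↭ (swap x y ↭-refl) N[v]) v~y v~x (~-sym G x~y)
... | inj₂ 4≤x | inj₁ (deg-y≡2 , _) = x , y , x≢y , v~x , v~y , x~y , 4≤x , inj₁ deg-y≡2
... | inj₂ 4≤x | inj₂ 4≤y = x , y , x≢y , v~x , v~y , x~y , 4≤x , inj₂ 4≤y
... | inj₁ (deg-x≡2 , _) | inj₂ 4≤y = y , x , ≢-sym x≢y , v~y , v~x , ~-sym G x~y , 4≤y , inj₁ deg-x≡2
... | inj₁ (_ , N[x]) | inj₁ (_ , N[y]) =
      ⊥-elim (proj₁ mnt (degree-2-triangle⇒traceable G conn N[v] N[x] N[y] v~x v~y x~y))
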